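{- Let $\mathcal{H} = \{H_n\}_{n=0}^{\infty}$ be a sequence of nonempty finite sets of positive integers. There exists a finite set $A$ of nonnegative integers that is a basis of order $\mathcal{H}$ or an asymptotic basis of order $\mathcal{H}$ if and only if \[ \liminf_{n\rightarrow\infty} \frac{\max(H_n)}{n} > 0. \]
   Context: For a set $A$ of nonnegative integers, a nonnegative integer $n$ and a positive integer $h$, $r_A(n,h)$ denotes the number of representations $n = a_1 + \cdots + a_h$ with $a_1,\ldots,a_h \in A$ and $a_1 \leq a_2 \leq \cdots \leq a_h$. For a nonempty finite set $H_n$ of positive integers, $r_A(n,H_n) = \sum_{h_n \in H_n} r_A(n,h_n)$. A set $A$ of nonnegative integers is a basis of order $\mathcal{H}$ if $r_A(n,H_n) \geq 1$ for all $n \geq 0$, and an asymptotic basis of order $\mathcal{H}$ if $r_A(n,H_n)\ge 1$ for all sufficiently large $n$. -}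

module Defs where

open import Data.Nat as ℕ using (ℕ; _≤_; _⊔_)
open import Data.List using (List)
open import Data.List.NonEmpty as L⁺ using (List⁺)
open import Data.List.Membership.Propositional using (_∈_)
open import Data.Vec as V using (Vec)
open import Data.Vec.Relation.Unary.All using (All)
open import Data.Vec.Relation.Unary.Linked using (Linked)
open import Data.Product using (Σ; ∃; ∃-syntax; _×_)
open import Data.Sum using (_⊎_)
open import Data.Integer using (+_)
open import Data.Rational as ℚ using (ℚ; 0ℚ)
open import Relation.Binary.PropositionalEquality using (_≡_)

OrderSeq : Set
OrderSeq = ℕ → List⁺ ℕ

maxH : List⁺ ℕ → ℕ
maxH H = L⁺.foldr₁ _⊔_ H

Rep : List ℕ → ℕ → ℕ → Set
Rep A n h = Σ (Vec ℕ h) λ as → All (_∈ A) as × Linked _≤_ as × V.sum as ≡ n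

-- r_A(n, H_n) ≥ 1 : some h ∈ H_n admits a representation.
RepH : List ℕ → ℕ → List⁺ ℕ → Set
RepH A n H = ∃[ h ] (h ∈ L⁺.toList H × Rep A n h)

IsBasis : OrderSeq → List ℕ → Set
IsBasis ℋ A = ∀ n → RepH A n (ℋ n)

IsAsymptoticBasis : OrderSeq → List ℕ → Set
IsAsymptoticBasis ℋ A = ∃[ N ] ∀ n → N ≤ n → RepH A n (ℋ n)

-- liminf_{n→∞} max(H_n)/n > 0 :
-- there is a rational c > 0 with max(H_n)/n ≥ c for all sufficiently large n,
-- written multiplicatively as c · n ≤ max(H_n).
LiminfMaxPos : OrderSeq → Set
LiminfMaxPos ℋ = ∃[ c ] (0ℚ ℚ.< c × ∃[ N ] ∀ n → N ≤ n →
                    c ℚ.* ((+ n) ℚ./ 1) ℚ.≤ ((+ maxH (ℋ n)) ℚ./ 1))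

{-# OPTIONS --safe #-}

-- If A is finite with largest element m, a representation of n by h ∈ H_n summands
-- gives n ≤ h·m ≤ max(H_n)·m, so max(H_n)/n ≥ 1/(m+1) eventually.  Conversely, if
-- n ≤ K·max(H_n) eventually, then A = {0,…,K} is an asymptotic basis: every n ≤ h·K
-- is the sorted sum 0 + ⋯ + 0 + r + K + ⋯ + K of h elements of A, with h = max(H_n).

module Submission where

open import Defs
open import Data.Nat using (ℕ; suc; zero; _+_; _*_; _∸_; _≤_; _≤?_; z≤n; s≤s)
open import Data.Nat.Properties as ℕP using (≤-refl; ≤-trans; module ≤-Reasoning)
open import Data.Nat.Coprimality as Coprime using (Coprime; 1-coprimeTo)
open import Data.Integer as ℤ using (+_; +≤+; +<+; -[1+_])
import Data.Integer.Properties as ℤP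
open import Data.Rational as ℚ using (ℚ; mkℚ; toℚᵘ)
import Data.Rational.Properties as ℚP
open import Data.Rational.Unnormalised as ℚᵘ using (mkℚᵘ)
import Data.Rational.Unnormalised.Properties as ℚᵘP
open import Data.List using ([]; _∷_; upTo)
open import Data.List.NonEmpty as List⁺ using (toList)
open import Data.List.Extrema.Nat using (max; xs≤max)
open import Data.List.Relation.Unary.All as ListAll using (All)
open import Data.List.Relation.Unary.Any using (here; there)
open import Data.List.Membership.Propositional using (_∈_)
open import Data.List.Membership.Propositional.Properties using (∈-upTo⁺)
open import Data.Vec as Vec using (Vec; []; _∷_; replicate)
open import Data.Vec.Relation.Unary.All as VecAll using ([]; _∷_)
open import Data.Vec.Relation.Unary.Linked using (Linked; []; [-]; _∷_)
open import Data.Product as Product using (∃-syntax; _,_)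
open import Data.Sum using (_⊎_; inj₁; inj₂; [_,_]′)
open import Function.Base using (id)
open import Function.Bundles using (_⇔_; mk⇔; Equivalence)
import Function.Properties.Equivalence as ⇔
open import Relation.Binary.Core using (Rel)
open import Relation.Binary.Definitions using (Reflexive)
open import Relation.Binary.PropositionalEquality using (_≡_; refl; sym; trans; cong; subst; subst₂)
open import Relation.Nullary using (yes; no)

maxH-∈ : ∀ H → maxH H ∈ toList H
maxH-∈ (x List⁺.∷ xs) = go x xs
  where
  go : ∀ x xs → maxH (x List⁺.∷ xs) ∈ x ∷ xs
  go x [] = here refl
  go x (y ∷ ys) with ℕP.⊔-sel x (maxH (y List⁺.∷ ys))
  ... | inj₁ max≡x = here max≡x
  ... | inj₂ max≡rest = there (subst (_∈ y ∷ ys) (sym max≡rest) (go y ys))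

∈⇒≤maxH : ∀ {h} H → h ∈ toList H → h ≤ maxH H
∈⇒≤maxH (x List⁺.∷ []) (here refl) = ≤-refl
∈⇒≤maxH (x List⁺.∷ y ∷ ys) (here refl) = ℕP.m≤m⊔n x _
∈⇒≤maxH (x List⁺.∷ y ∷ ys) (there h∈) =
  ≤-trans (∈⇒≤maxH (y List⁺.∷ ys) h∈) (ℕP.m≤n⊔m x _)

All≤⇒sum≤* : ∀ {m n} {v : Vec ℕ n} → VecAll.All (_≤ m) v → Vec.sum v ≤ n * m
All≤⇒sum≤* [] = z≤n
All≤⇒sum≤* (x≤m ∷ v≤m) = ℕP.+-mono-≤ x≤m (All≤⇒sum≤* v≤m)

Rep⇒≤*max : ∀ {A n h} → Rep A n h → n ≤ h * max 0 A
Rep⇒≤*max {A} (v , v⊆A , _ , refl) =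
  All≤⇒sum≤* (VecAll.map (ListAll.lookup (xs≤max 0 A)) v⊆A)

All-replicate : ∀ {a p} {X : Set a} {P : X → Set p} n {x} → P x → VecAll.All P (replicate n x)
All-replicate zero _ = []
All-replicate (suc n) Px = Px ∷ All-replicate n Px

sum-replicate : ∀ n x → Vec.sum (replicate n x) ≡ n * x
sum-replicate zero x = refl
sum-replicate (suc n) x = cong (_+_ x) (sum-replicate n x)

module _ {a ℓ} {X : Set a} {R : Rel X ℓ} where

  Linked-∷⁺ : ∀ {n x} {v : Vec X n} → VecAll.All (R x) v → Linked R v → Linked R (x ∷ v)
  Linked-∷⁺ [] _ = [-]
  Linked-∷⁺ (Rxy ∷ _) Rv = Rxy ∷ Rv

  Linked-replicate : Reflexive R → ∀ n {x} → Linked R (replicate n x)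
  Linked-replicate R-refl zero = []
  Linked-replicate R-refl (suc n) =
    Linked-∷⁺ (All-replicate n R-refl) (Linked-replicate R-refl n)

Rep-from-interval : ∀ {A k} → (∀ {x} → x ≤ k → x ∈ A) → ∀ h {n} → n ≤ h * k → Rep A n h
Rep-from-interval interval⊆A zero z≤n = [] , [] , [] , refl
Rep-from-interval {k = k} interval⊆A (suc h) {n} n≤ with n ≤? h * k
... | yes n≤hk with Rep-from-interval interval⊆A h n≤hk
...   | v , v⊆A , sorted , sum≡n =
  0 ∷ v , interval⊆A z≤n ∷ v⊆A , Linked-∷⁺ (VecAll.universal (λ _ → z≤n) v) sorted , sum≡n
Rep-from-interval {k = k} interval⊆A (suc h) {n} n≤ | no n≰hk =
  n ∸ h * k ∷ replicate h k ,
  interval⊆A r≤k ∷ All-replicate h (interval⊆A ≤-refl) ,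
  Linked-∷⁺ (All-replicate h r≤k) (Linked-replicate ≤-refl h) ,
  trans (cong (_+_ (n ∸ h * k)) (sum-replicate h k)) (ℕP.m∸n+n≡m (ℕP.<⇒≤ (ℕP.≰⇒> n≰hk)))
  where
  r≤k : n ∸ h * k ≤ k
  r≤k = ℕP.m≤n+o⇒m∸n≤o n (h * k) (subst (n ≤_) (ℕP.+-comm k (h * k)) n≤)

fromℕ : ℕ → ℚ
fromℕ n = mkℚ (+ n) 0 (Coprime.sym (1-coprimeTo n))

+n/1≡fromℕ : ∀ n → + n ℚ./ 1 ≡ fromℕ n
+n/1≡fromℕ n = ℚP.normalize-coprime _

*-≤⇔toℚᵘ : ∀ p q r → p ℚ.* q ℚ.≤ r ⇔ toℚᵘ p ℚᵘ.* toℚᵘ q ℚᵘ.≤ toℚᵘ r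
*-≤⇔toℚᵘ p q r = mk⇔
  (λ pq≤r → ℚᵘP.≤-respˡ-≃ (ℚP.toℚᵘ-homo-* p q) (ℚP.toℚᵘ-mono-≤ pq≤r))
  (λ pq≤r → ℚP.toℚᵘ-cancel-≤ (ℚᵘP.≤-respˡ-≃ (ℚᵘP.≃-sym (ℚP.toℚᵘ-homo-* p q)) pq≤r))

mkℚᵘ-*-≤⇔ : ∀ p d n M → mkℚᵘ (+ p) d ℚᵘ.* mkℚᵘ (+ n) 0 ℚᵘ.≤ mkℚᵘ (+ M) 0 ⇔ p * n ≤ M * suc d
mkℚᵘ-*-≤⇔ p d n M = mk⇔
  (λ { (ℚᵘ.*≤* le) → ℤP.drop‿+≤+ (subst₂ ℤ._≤_ lhs rhs le) })
  (λ le → ℚᵘ.*≤* (subst₂ ℤ._≤_ (sym lhs) (sym rhs) (+≤+ le)))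
  where
  lhs : (+ p ℤ.* + n) ℤ.* + 1 ≡ + (p * n)
  lhs = trans (ℤP.*-identityʳ _) (sym (ℤP.pos-* p n))
  rhs : + M ℤ.* + suc (d * 1) ≡ + (M * suc d)
  rhs = trans (sym (ℤP.pos-* M _)) (cong (λ t → + (M * suc t)) (ℕP.*-identityʳ d))

mkℚ-*-≤⇔ : ∀ p d .(c : Coprime p (suc d)) n M →
  mkℚ (+ p) d c ℚ.* (+ n ℚ./ 1) ℚ.≤ (+ M ℚ./ 1) ⇔ p * n ≤ M * suc d
mkℚ-*-≤⇔ p d c n M rewrite +n/1≡fromℕ n | +n/1≡fromℕ M =
  ⇔.trans (*-≤⇔toℚᵘ (mkℚ (+ p) d c) (fromℕ n) (fromℕ M)) (mkℚᵘ-*-≤⇔ p d n M)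

MaxGrowsLinearly : OrderSeq → Set
MaxGrowsLinearly ℋ = ∃[ K ] ∃[ N ] ∀ n → N ≤ n → n ≤ maxH (ℋ n) * K

IsBasis⇒IsAsymptoticBasis : ∀ ℋ {A} → IsBasis ℋ A → IsAsymptoticBasis ℋ A
IsBasis⇒IsAsymptoticBasis ℋ basis = 0 , λ n _ → basis n

IsAsymptoticBasis⇒MaxGrowsLinearly : ∀ ℋ {A} → IsAsymptoticBasis ℋ A → MaxGrowsLinearly ℋ
IsAsymptoticBasis⇒MaxGrowsLinearly ℋ {A} (N , represented) = max 0 A , N , bound
  where
  bound : ∀ n → N ≤ n → n ≤ maxH (ℋ n) * max 0 A
  bound n N≤n with represented n N≤n
  ... | h , h∈H , rep = ≤-trans (Rep⇒≤*max rep) (ℕP.*-monoˡ-≤ (max 0 A) (∈⇒≤maxH (ℋ n) h∈H))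

MaxGrowsLinearly⇒IsAsymptoticBasis : ∀ ℋ → MaxGrowsLinearly ℋ → ∃[ A ] IsAsymptoticBasis ℋ A
MaxGrowsLinearly⇒IsAsymptoticBasis ℋ (K , N , bound) = upTo (suc K) , N , λ n N≤n →
  maxH (ℋ n) , maxH-∈ (ℋ n) ,
  Rep-from-interval (λ x≤K → ∈-upTo⁺ (s≤s x≤K)) (maxH (ℋ n)) (bound n N≤n)

MaxGrowsLinearly⇒LiminfMaxPos : ∀ ℋ → MaxGrowsLinearly ℋ → LiminfMaxPos ℋ
MaxGrowsLinearly⇒LiminfMaxPos ℋ (K , N , bound) =
  mkℚ (+ 1) K (1-coprimeTo _) , ℚP.positive⁻¹ _ , N , λ n N≤n →
  Equivalence.from (mkℚ-*-≤⇔ 1 K _ n (maxH (ℋ n))) (begin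
    1 * n              ≡⟨ ℕP.*-identityˡ n ⟩
    n                  ≤⟨ bound n N≤n ⟩
    maxH (ℋ n) * K     ≤⟨ ℕP.*-monoʳ-≤ (maxH (ℋ n)) (ℕP.n≤1+n K) ⟩
    maxH (ℋ n) * suc K ∎)
  where open ≤-Reasoning

LiminfMaxPos⇒MaxGrowsLinearly : ∀ ℋ → LiminfMaxPos ℋ → MaxGrowsLinearly ℋ
LiminfMaxPos⇒MaxGrowsLinearly _ (mkℚ (+ zero) _ _ , ℚ.*<* (+<+ ()) , _)
LiminfMaxPos⇒MaxGrowsLinearly _ (mkℚ -[1+ _ ] _ _ , ℚ.*<* () , _)
LiminfMaxPos⇒MaxGrowsLinearly ℋ (mkℚ (+ suc p) d c , _ , N , cn≤max) = suc d , N , λ n N≤n →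
  ≤-trans (ℕP.m≤m+n n (p * n)) (Equivalence.to (mkℚ-*-≤⇔ (suc p) d c n (maxH (ℋ n))) (cn≤max n N≤n))

theorem1 : (ℋ : OrderSeq) → (∀ n → All (λ h → 1 Data.Nat.≤ h) (toList (ℋ n))) →
    ((∃[ A ] (IsBasis ℋ A ⊎ IsAsymptoticBasis ℋ A)) ⇔ LiminfMaxPos ℋ)
theorem1 ℋ _ = mk⇔
  (λ (A , basis) → MaxGrowsLinearly⇒LiminfMaxPos ℋ
    (IsAsymptoticBasis⇒MaxGrowsLinearly ℋ ([ IsBasis⇒IsAsymptoticBasis ℋ , id ]′ basis)))
  (λ liminf → Product.map₂ inj₂
    (MaxGrowsLinearly⇒IsAsymptoticBasis ℋ (LiminfMaxPos⇒MaxGrowsLinearly ℋ liminf)))
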